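{- Let $m\in\mathbb N_{\ge1}$. There exists a number $K_m$ such that for every $K\ge K_m$ and every $\varepsilon>0$ there is no deterministic $(m-\varepsilon)$-competitive online algorithm for Online Makespan Scheduling under $K$ Scenarios on $m$ machines, even when restricted to instances with unit processing times and $|S_k|\le m$ for every scenario $S_k$.
   Context: Online Makespan Scheduling under Scenarios with $m$ machines and $K$ scenarios (both known in advance): an instance consists of $n$ jobs with processing times $p_j\ge0$ and scenarios $S_1,\dots,S_K\subseteq[n]$ (not known in advance); jobs are revealed in order $1,\dots,n$, and on revelation of job $j$ the algorithm learns $p_j$ and which scenarios contain $j$, and must irrevocably assign $j$ to a machine $\tau(j)\in[m]$. With $J_i=\tau^{ -1}(i)$ and $p(S)=\sum_{j\in S}p_j$, the makespan is $\max_{k}\max_i p(J_i\cap S_k)$; an algorithm is $\rho$-competitive if its makespan is always at most $\rho$ times the offline optimum (minimum makespan over all partitions of $[n]$ into $m$ machines). -}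

module Defs where

open import Data.Nat using (ℕ; zero; suc; _+_; _*_; _≤_; _⊔_)
open import Data.Bool using (Bool; true; false; if_then_else_; _∧_)
open import Data.Fin using (Fin; _≟_)
open import Data.Fin.Subset using (Subset)
open import Data.Vec using (lookup)
open import Data.List using (List; []; _∷_; length; foldr; map; concatMap; allFin; filter)
open import Data.List.Relation.Unary.All using (All)
open import Data.Product using (_×_; proj₁; proj₂)
open import Relation.Nullary.Decidable using (⌊_⌋)
open import Relation.Binary.PropositionalEquality using (_≡_)

-- A revealed job over K scenarios: its processing time p_j and the set of
-- scenarios containing it (as a subset of Fin K).
Job : ℕ → Set
Job K = ℕ × Subset K

-- An instance: the jobs in revelation order 1,…,n.
Instance : ℕ → Set
Instance K = List (Job K)

inScen : {K : ℕ} → Fin K → Job K → Bool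
inScen k j = lookup (proj₂ j) k

-- A deterministic online algorithm for m machines and K scenarios:
-- given the list of previously revealed jobs (most recent first) and the
-- currently revealed job, it returns the machine for the current job.
-- (Its own earlier decisions are determined by the history, by determinism.)
OnlineAlg : ℕ → ℕ → Set
OnlineAlg K m = List (Job K) → Job K → Fin m

runFrom : {K m : ℕ} → OnlineAlg K m → List (Job K) → Instance K → List (Fin m)
runFrom alg hist [] = []
runFrom alg hist (j ∷ js) = alg hist j ∷ runFrom alg (j ∷ hist) js

run : {K m : ℕ} → OnlineAlg K m → Instance K → List (Fin m)
run alg js = runFrom alg [] js

load : {K m : ℕ} → Instance K → List (Fin m) → Fin K → Fin m → ℕ
load [] _ k i = 0
load (_ ∷ _) [] k i = 0
load (j ∷ js) (t ∷ ts) k i =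
  (if inScen k j ∧ ⌊ t ≟ i ⌋ then proj₁ j else 0) + load js ts k i

makespan : {K m : ℕ} → Instance K → List (Fin m) → ℕ
makespan {K} {m} js τ =
  foldr _⊔_ 0 (concatMap (λ k → map (λ i → load js τ k i) (allFin m)) (allFin K))

IsAssignment : {K m : ℕ} → Instance K → List (Fin m) → Set
IsAssignment js τ = length τ ≡ length js

IsOptimal : {K m : ℕ} → Instance K → List (Fin m) → Set
IsOptimal {K} {m} js τ =
  IsAssignment js τ × ((τ' : List (Fin m)) → IsAssignment js τ' → makespan js τ ≤ makespan js τ')

scenarioSize : {K : ℕ} → Instance K → Fin K → ℕ
scenarioSize js k = length (filter (λ j → inScen k j ≡? true) js)
  where
  open import Data.Bool.Properties using () renaming (_≟_ to _≡?_)

UnitSmall : {K : ℕ} → ℕ → Instance K → Set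
UnitSmall {K} m js = All (λ j → proj₁ j ≡ 1) js × ((k : Fin K) → scenarioSize js k ≤ m)

-- The algorithm is (m - a/b)-competitive on restricted instances:
-- ALG ≤ (m - a/b)·OPT, written without subtraction as
-- b·ALG + a·OPT ≤ m·b·OPT.
CompetitiveUnitSmall : {K m : ℕ} → ℕ → ℕ → OnlineAlg K m → Set
CompetitiveUnitSmall {K} {m} a b alg =
  (js : Instance K) → UnitSmall m js →
  (σ : List (Fin m)) → IsOptimal js σ →
  b * makespan js (run alg js) + a * makespan js σ ≤ m * b * makespan js σ

{-# OPTIONS --safe #-}

-- The adversary works in levels, keeping on every machine c a chain: a scenario all of whose
-- jobs the algorithm has put on c.  A level n+1 block consists of (m+1)^m + 1 level n blocks
-- revealed one after another on disjoint sets of scenarios; by pigeonhole two of them, i < j,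
-- end with the same profile of chain lengths.  One more unit job is then revealed, in a fresh
-- scenario and in every chain of block i that is neither empty nor full.  Whichever machine d
-- the algorithm picks, the chain of d (from block i, or the fresh scenario) grows by one, while
-- every other machine keeps its chain from block j, which the new job does not touch.  So
-- either some chain is full or the total chain length grows with the level, and after m·m
-- levels m jobs of one scenario share a machine: ALG ≥ m.  Offline, block i is laid out
-- cyclically starting one machine after the new job, so no scenario has two jobs on one
-- machine: OPT = 1, and no scenario has more than m jobs.

module Submission where

open import Defs
open import Data.Nat using (ℕ; _≤_)
open import Data.Product using (∃-syntax)
open import Relation.Nullary using (¬_)

open import Data.Nat as ℕ using (zero; suc; _+_; _*_; _⊔_; _∸_; _<_; _^_; z≤n; s≤s; _<?_; _≤?_)
open import Data.Nat.Properties hiding (_≟_)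
open import Data.Nat.DivMod using (_mod_; _%_; m<n⇒m%n≡m; m≤n⇒m%n≡m; m%n<n; %-distribˡ-+; m≤n⇒[n∸m]%m≡n%m)
open import Data.Bool using (true; false; if_then_else_; _∧_)
open import Data.Bool.Properties using (∧-zeroʳ)
open import Data.Fin as Fin using (Fin; zero; suc; toℕ; fromℕ<; _≟_)
import Data.Fin.Properties as Finₚ
open import Data.Fin.Properties using (toℕ-fromℕ<)
open import Data.Vec using (tabulate)
open import Data.Vec.Properties using (lookup∘tabulate)
open import Data.List using (List; []; _∷_; length; _++_; _ʳ++_; foldr; filter)
open import Data.List.Properties using (length-++; length-ʳ++; filter-++)
open import Data.List.Relation.Unary.All using (All; []; _∷_)
import Data.List.Relation.Unary.All.Properties as Allₚ
open import Data.List.Relation.Unary.Any using (Any; here; there)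
import Data.List.Relation.Unary.Any.Properties as Anyₚ
open import Data.Product using (_×_; _,_; proj₁; proj₂)
open import Data.Sum using (_⊎_; inj₁; inj₂)
open import Data.Empty using (⊥-elim)
open import Function using (_∘_)
open import Relation.Nullary using (Dec; yes; no)
open import Relation.Nullary.Decidable using (⌊_⌋; _×-dec_; _⊎-dec_; dec-true; dec-false; isYes≗does)
open import Relation.Binary.Definitions using (tri<; tri≈; tri>)
open import Relation.Binary.PropositionalEquality
open import Algebra.Properties.CommutativeMonoid.Sum +-0-commutativeMonoid
  using (sum-syntax; sum-cong-≗; ∑-distrib-+; sum-replicate-zero)

∑-indicator : ∀ {n} (t : Fin n) (x : ℕ) → ∑[ i < n ] (if ⌊ t ≟ i ⌋ then x else 0) ≡ x
∑-indicator {suc n} zero x = trans (cong (x +_) (sum-replicate-zero n)) (+-identityʳ x)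
∑-indicator {suc n} (suc t) x =
  trans (sum-cong-≗ (λ i → cong (λ b → if b then x else 0) (⌊suc≟suc⌋ i))) (∑-indicator t x)
  where
  ⌊suc≟suc⌋ : ∀ i → ⌊ suc t ≟ suc i ⌋ ≡ ⌊ t ≟ i ⌋
  ⌊suc≟suc⌋ i with t ≟ i
  ... | yes _ = refl
  ... | no _ = refl

∑-bound : ∀ {n} (g : Fin n → ℕ) {B : ℕ} → (∀ i → g i ≤ B) → ∑[ i < n ] g i ≤ n * B
∑-bound {zero} g g≤B = z≤n
∑-bound {suc n} g g≤B = +-mono-≤ (g≤B zero) (∑-bound (g ∘ suc) (g≤B ∘ suc))

if-+-if : ∀ b (x y : ℕ) → (if b then x else 0) + (if b then y else 0) ≡ (if b then x + y else 0)
if-+-if true x y = refl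
if-+-if false x y = refl

if≤1 : ∀ b → (if b then 1 else 0) ≤ 1
if≤1 true = ≤-refl
if≤1 false = z≤n

⌊⌋-yes : ∀ {A : Set} (a? : Dec A) → A → ⌊ a? ⌋ ≡ true
⌊⌋-yes a? a = trans (isYes≗does a?) (dec-true a? a)

⌊⌋-no : ∀ {A : Set} (a? : Dec A) → ¬ A → ⌊ a? ⌋ ≡ false
⌊⌋-no a? ¬a = trans (isYes≗does a?) (dec-false a? ¬a)

concatFin : ∀ {A : Set} (r : ℕ) → (Fin r → List A) → List A
concatFin zero xs = []
concatFin (suc r) xs = xs zero ++ concatFin r (xs ∘ suc)

length-concatFin : ∀ {A : Set} r (xs : Fin r → List A) {T} →
                   (∀ q → length (xs q) ≡ T) → length (concatFin r xs) ≡ r * T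
length-concatFin zero xs eq = refl
length-concatFin (suc r) xs eq =
  trans (length-++ (xs zero)) (cong₂ _+_ (eq zero) (length-concatFin r (xs ∘ suc) (eq ∘ suc)))

length-concatFin-≡ : ∀ {A B : Set} r (xs : Fin r → List A) (ys : Fin r → List B) →
                     (∀ q → length (xs q) ≡ length (ys q)) → length (concatFin r xs) ≡ length (concatFin r ys)
length-concatFin-≡ zero xs ys eq = refl
length-concatFin-≡ (suc r) xs ys eq = begin
  length (xs zero ++ concatFin r (xs ∘ suc))                 ≡⟨ length-++ (xs zero) ⟩
  length (xs zero) + length (concatFin r (xs ∘ suc))
    ≡⟨ cong₂ _+_ (eq zero) (length-concatFin-≡ r (xs ∘ suc) (ys ∘ suc) (eq ∘ suc)) ⟩
  length (ys zero) + length (concatFin r (ys ∘ suc))         ≡⟨ length-++ (ys zero) ⟨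
  length (ys zero ++ concatFin r (ys ∘ suc))                 ∎
  where open ≡-Reasoning

All-concatFin : ∀ {A : Set} {P : A → Set} r (xs : Fin r → List A) →
                (∀ q → All P (xs q)) → All P (concatFin r xs)
All-concatFin zero xs all = []
All-concatFin (suc r) xs all = Allₚ.++⁺ (all zero) (All-concatFin r (xs ∘ suc) (all ∘ suc))

foldr-⊔-lub : ∀ {xs : List ℕ} {B} → All (_≤ B) xs → foldr _⊔_ 0 xs ≤ B
foldr-⊔-lub [] = z≤n
foldr-⊔-lub (x≤B ∷ xs≤B) = ⊔-lub x≤B (foldr-⊔-lub xs≤B)

foldr-⊔-upper : ∀ {xs : List ℕ} {v} → Any (v ≤_) xs → v ≤ foldr _⊔_ 0 xs
foldr-⊔-upper (here v≤x) = ≤-trans v≤x (m≤m⊔n _ _)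
foldr-⊔-upper {x ∷ xs} (there p) = ≤-trans (foldr-⊔-upper p) (m≤n⊔m x _)

module _ {K : ℕ} where

  scenarioSize-++ : (js₁ js₂ : Instance K) (k : Fin K) →
                    scenarioSize (js₁ ++ js₂) k ≡ scenarioSize js₁ k + scenarioSize js₂ k
  scenarioSize-++ js₁ js₂ k = trans (cong length (filter-++ _ js₁ js₂)) (length-++ (filter _ js₁))

  scenarioSize-snoc : (js : Instance K) (j : Job K) (k : Fin K) →
                      scenarioSize (js ++ j ∷ []) k ≡ scenarioSize js k + (if inScen k j then 1 else 0)
  scenarioSize-snoc js j k = trans (scenarioSize-++ js (j ∷ []) k) (cong (scenarioSize js k +_) singleton)
    where
    singleton : scenarioSize (j ∷ []) k ≡ (if inScen k j then 1 else 0)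
    singleton with inScen k j
    ... | true = refl
    ... | false = refl

  scenarioSize-concatFin-empty : ∀ r (js : Fin r → Instance K) k →
                                 (∀ q → scenarioSize (js q) k ≡ 0) → scenarioSize (concatFin r js) k ≡ 0
  scenarioSize-concatFin-empty zero js k empty = refl
  scenarioSize-concatFin-empty (suc r) js k empty =
    trans (scenarioSize-++ (js zero) _ k)
          (cong₂ _+_ (empty zero) (scenarioSize-concatFin-empty r (js ∘ suc) k (empty ∘ suc)))

module _ {K m : ℕ} where

  runFrom-++ : (alg : OnlineAlg K m) (h xs ys : List (Job K)) →
               runFrom alg h (xs ++ ys) ≡ runFrom alg h xs ++ runFrom alg (xs ʳ++ h) ys
  runFrom-++ alg h [] ys = refl
  runFrom-++ alg h (x ∷ xs) ys = cong (alg h x ∷_) (runFrom-++ alg (x ∷ h) xs ys)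

  length-runFrom : (alg : OnlineAlg K m) (h js : List (Job K)) → length (runFrom alg h js) ≡ length js
  length-runFrom alg h [] = refl
  length-runFrom alg h (j ∷ js) = cong suc (length-runFrom alg (j ∷ h) js)

  load-++ : (js₁ js₂ : Instance K) (τ₁ τ₂ : List (Fin m)) → length τ₁ ≡ length js₁ → ∀ k i →
            load (js₁ ++ js₂) (τ₁ ++ τ₂) k i ≡ load js₁ τ₁ k i + load js₂ τ₂ k i
  load-++ [] js₂ [] τ₂ eq k i = refl
  load-++ (j ∷ js₁) js₂ (t ∷ τ₁) τ₂ eq k i =
    trans (cong (_ +_) (load-++ js₁ js₂ τ₁ τ₂ (suc-injective eq) k i))
          (sym (+-assoc (if inScen k j ∧ ⌊ t ≟ i ⌋ then proj₁ j else 0) _ _))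

  load-empty : (js : Instance K) (τ : List (Fin m)) (k : Fin K) (i : Fin m) →
               scenarioSize js k ≡ 0 → load js τ k i ≡ 0
  load-empty [] τ k i empty = refl
  load-empty (j ∷ js) [] k i empty = refl
  load-empty (j ∷ js) (t ∷ τ) k i empty with inScen k j
  ... | false = load-empty js τ k i empty

  scenarioSize≡∑load : (js : Instance K) (τ : List (Fin m)) (k : Fin K) →
                       All (λ j → proj₁ j ≡ 1) js → length τ ≡ length js →
                       scenarioSize js k ≡ ∑[ i < m ] load js τ k i
  scenarioSize≡∑load [] [] k [] eq = sym (sum-replicate-zero m)
  scenarioSize≡∑load (j ∷ js) (t ∷ τ) k (unit ∷ units) eq with inScen k j
  ... | false = scenarioSize≡∑load js τ k units (suc-injective eq)
  ... | true = begin
    suc (scenarioSize js k)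
      ≡⟨ cong₂ _+_ (sym unit) (scenarioSize≡∑load js τ k units (suc-injective eq)) ⟩
    proj₁ j + ∑[ i < m ] load js τ k i
      ≡⟨ cong (_+ _) (∑-indicator t (proj₁ j)) ⟨
    ∑[ i < m ] (if ⌊ t ≟ i ⌋ then proj₁ j else 0) + ∑[ i < m ] load js τ k i
      ≡⟨ ∑-distrib-+ (λ i → if ⌊ t ≟ i ⌋ then proj₁ j else 0) (load js τ k) ⟨
    ∑[ i < m ] ((if ⌊ t ≟ i ⌋ then proj₁ j else 0) + load js τ k i)
      ∎
    where open ≡-Reasoning

  load-snoc : (js : Instance K) (j : Job K) (τ : List (Fin m)) (t : Fin m) → length τ ≡ length js → ∀ k i →
              load (js ++ j ∷ []) (τ ++ t ∷ []) k i ≡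
              load js τ k i + (if inScen k j ∧ ⌊ t ≟ i ⌋ then proj₁ j else 0)
  load-snoc js j τ t eq k i = trans (load-++ js (j ∷ []) τ (t ∷ []) eq k i) (cong (load js τ k i +_) (+-identityʳ _))

  load-concatFin-local : ∀ r (js : Fin r → Instance K) (τ : Fin r → List (Fin m)) →
                         (∀ q → length (τ q) ≡ length (js q)) → ∀ q k i →
                         (∀ q′ → q′ ≢ q → scenarioSize (js q′) k ≡ 0) →
                         load (concatFin r js) (concatFin r τ) k i ≡ load (js q) (τ q) k i
  load-concatFin-local (suc r) js τ lengths zero k i others = begin
    load (concatFin (suc r) js) (concatFin (suc r) τ) k i
      ≡⟨ load-++ (js zero) _ (τ zero) _ (lengths zero) k i ⟩
    load (js zero) (τ zero) k i + load (concatFin r (js ∘ suc)) (concatFin r (τ ∘ suc)) k i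
      ≡⟨ cong (load (js zero) (τ zero) k i +_) (load-empty (concatFin r (js ∘ suc)) (concatFin r (τ ∘ suc)) k i
           (scenarioSize-concatFin-empty r (js ∘ suc) k (λ q → others (suc q) λ ()))) ⟩
    load (js zero) (τ zero) k i + 0
      ≡⟨ +-identityʳ _ ⟩
    load (js zero) (τ zero) k i
      ∎
    where open ≡-Reasoning
  load-concatFin-local (suc r) js τ lengths (suc q) k i others = begin
    load (concatFin (suc r) js) (concatFin (suc r) τ) k i
      ≡⟨ load-++ (js zero) _ (τ zero) _ (lengths zero) k i ⟩
    load (js zero) (τ zero) k i + load (concatFin r (js ∘ suc)) (concatFin r (τ ∘ suc)) k i
      ≡⟨ cong₂ _+_ (load-empty (js zero) (τ zero) k i (others zero λ ()))
                   (load-concatFin-local r (js ∘ suc) (τ ∘ suc) (lengths ∘ suc) q k i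
                      (λ q′ q′≢q → others (suc q′) (q′≢q ∘ Finₚ.suc-injective))) ⟩
    load (js (suc q)) (τ (suc q)) k i
      ∎
    where open ≡-Reasoning

  load≤makespan : (js : Instance K) (τ : List (Fin m)) (k : Fin K) (i : Fin m) → load js τ k i ≤ makespan js τ
  load≤makespan js τ k i =
    foldr-⊔-upper (Anyₚ.concat⁺ (Anyₚ.map⁺ (Anyₚ.tabulate⁺ k (Anyₚ.map⁺ (Anyₚ.tabulate⁺ i ≤-refl)))))

  makespan-lub : (js : Instance K) (τ : List (Fin m)) {B : ℕ} →
                 (∀ k i → load js τ k i ≤ B) → makespan js τ ≤ B
  makespan-lub js τ bound =
    foldr-⊔-lub (Allₚ.concat⁺ (Allₚ.map⁺ (Allₚ.tabulate⁺ λ k →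
      Allₚ.map⁺ (Allₚ.tabulate⁺ λ i → bound k i))))

not-competitive : ∀ {K m'} (alg : OnlineAlg K (suc m')) (js : Instance K) (σ : List (Fin (suc m'))) →
  All (λ j → proj₁ j ≡ 1) js → IsAssignment js σ → (∀ k i → load js σ k i ≤ 1) →
  (k : Fin K) (i : Fin (suc m')) → suc m' ≤ load js (run alg js) k i →
  (a b : ℕ) → 1 ≤ a → ¬ CompetitiveUnitSmall a b alg
not-competitive {m' = m'} alg js σ units σ-assigns σ≤1 k i forced a b 1≤a competitive =
  <⇒≱ 1≤a (+-cancelˡ-≤ (b * m) a 0 b*m+a≤b*m)
  where
  m : ℕ
  m = suc m'

  ALG OPT : ℕ
  ALG = makespan js (run alg js)
  OPT = makespan js σ

  scenario-nonempty : scenarioSize js k ≢ 0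
  scenario-nonempty empty = <⇒≱ (s≤s z≤n) (≤-trans forced (≤-reflexive (load-empty js (run alg js) k i empty)))

  makespan≥1 : ∀ τ → IsAssignment js τ → 1 ≤ makespan js τ
  makespan≥1 τ τ-assigns = n≢0⇒n>0 λ makespan≡0 → scenario-nonempty (n≤0⇒n≡0 (begin
    scenarioSize js k              ≡⟨ scenarioSize≡∑load js τ k units τ-assigns ⟩
    ∑[ i < m ] load js τ k i       ≤⟨ ∑-bound (load js τ k) (load≤makespan js τ k) ⟩
    m * makespan js τ              ≡⟨ cong (m *_) makespan≡0 ⟩
    m * 0                          ≡⟨ *-zeroʳ m ⟩
    0                              ∎))
    where open ≤-Reasoning

  σ-optimal : IsOptimal js σ
  σ-optimal = σ-assigns , λ τ τ-assigns → ≤-trans (makespan-lub js σ σ≤1) (makespan≥1 τ τ-assigns)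

  ALG≥m : m ≤ ALG
  ALG≥m = ≤-trans forced (load≤makespan js (run alg js) k i)

  OPT≡1 : OPT ≡ 1
  OPT≡1 = ≤-antisym (makespan-lub js σ σ≤1) (makespan≥1 σ σ-assigns)

  unit-small : UnitSmall m js
  unit-small = units , λ k′ → begin
    scenarioSize js k′             ≡⟨ scenarioSize≡∑load js σ k′ units σ-assigns ⟩
    ∑[ i < m ] load js σ k′ i      ≤⟨ ∑-bound (load js σ k′) (σ≤1 k′) ⟩
    m * 1                          ≡⟨ *-identityʳ m ⟩
    m                              ∎
    where open ≤-Reasoning

  b*m+a≤b*m : b * m + a ≤ b * m + 0
  b*m+a≤b*m = begin
    b * m + a          ≤⟨ +-mono-≤ (*-monoʳ-≤ b ALG≥m) (≤-reflexive (sym (*-identityʳ a))) ⟩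
    b * ALG + a * 1    ≡⟨ cong (λ o → b * ALG + a * o) OPT≡1 ⟨
    b * ALG + a * OPT  ≤⟨ competitive js unit-small σ σ-optimal ⟩
    m * b * OPT        ≡⟨ cong (m * b *_) OPT≡1 ⟩
    m * b * 1          ≡⟨ *-identityʳ (m * b) ⟩
    m * b              ≡⟨ *-comm m b ⟩
    b * m              ≡⟨ +-identityʳ (b * m) ⟨
    b * m + 0          ∎
    where open ≤-Reasoning

module Machines (m' : ℕ) where

  m : ℕ
  m = suc m'

  -- One more than the number of chain-length profiles Fin m → {0..m}, so that two copies agree.
  copies : ℕ
  copies = suc (suc m ^ m)

  blockSize : ℕ → ℕ
  blockSize zero = 0
  blockSize (suc n) = suc (copies * blockSize n)

  machineAt : ℕ → Fin m
  machineAt t = t mod m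

  windowLoad : ℕ → ℕ → Fin m → ℕ
  windowLoad D zero i = 0
  windowLoad D (suc l) i = (if ⌊ machineAt D ≟ i ⌋ then 1 else 0) + windowLoad (suc D) l i

  %-shift-≢ : ∀ s D → suc s < m → (suc s + D) % m ≢ D % m
  %-shift-≢ s D s<m eq = no-fixpoint (m%n<n D m) shifted
    where
    open ≡-Reasoning
    shifted : (suc s + D % m) % m ≡ D % m
    shifted = begin
      (suc s + D % m) % m           ≡⟨ cong (λ a → (a + D % m) % m) (m<n⇒m%n≡m s<m) ⟨
      (suc s % m + D % m) % m       ≡⟨ %-distribˡ-+ (suc s) D m ⟨
      (suc s + D) % m               ≡⟨ eq ⟩
      D % m                         ∎
    no-fixpoint : ∀ {r} → r < m → (suc s + r) % m ≢ r
    no-fixpoint {r} r<m fixed with suc s + r <? m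
    ... | yes small = 1+n≢0 (+-cancelʳ-≡ r (suc s) 0 (trans (sym (m<n⇒m%n≡m small)) fixed))
    ... | no big = <⇒≢ s<m (sym (+-cancelʳ-≡ r m (suc s) (begin
      m + r                  ≡⟨ +-comm m r ⟩
      r + m                  ≡⟨ cong (_+ m) wrapped ⟨
      (suc s + r ∸ m) + m    ≡⟨ m∸n+n≡m (≮⇒≥ big) ⟩
      suc s + r              ∎)))
      where
      wrapped : suc s + r ∸ m ≡ r
      wrapped = begin
        suc s + r ∸ m          ≡⟨ m<n⇒m%n≡m (subst (suc s + r ∸ m <_) (m+n∸m≡n m m)
                                    (∸-monoˡ-< (+-mono-< s<m r<m) (≮⇒≥ big))) ⟨
        (suc s + r ∸ m) % m    ≡⟨ m≤n⇒[n∸m]%m≡n%m (≮⇒≥ big) ⟩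
        (suc s + r) % m        ≡⟨ fixed ⟩
        r                      ∎

  windowLoad-avoids : ∀ s D l → suc s + l ≤ m → windowLoad (suc s + D) l (machineAt D) ≡ 0
  windowLoad-avoids s D zero fits = refl
  windowLoad-avoids s D (suc l) fits with machineAt (suc s + D) ≟ machineAt D
  ... | yes same = ⊥-elim (%-shift-≢ s D (≤-trans (m<m+n (suc s) (s≤s z≤n)) fits)
                     (trans (sym (toℕ-fromℕ< _)) (trans (cong toℕ same) (toℕ-fromℕ< _))))
  ... | no _ = windowLoad-avoids (suc s) D l (subst (_≤ m) (+-suc (suc s) l) fits)

  windowLoad≤1 : ∀ D l i → l ≤ m → windowLoad D l i ≤ 1
  windowLoad≤1 D zero i fits = z≤n
  windowLoad≤1 D (suc l) i fits with machineAt D ≟ i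
  ... | yes refl = ≤-reflexive (cong suc (windowLoad-avoids 0 D l fits))
  ... | no _ = windowLoad≤1 (suc D) l i (≤-trans (n≤1+n l) fits)

module Adversary (m' K : ℕ) (alg : OnlineAlg K (suc m')) where
  open Machines m'

  History : Set
  History = List (Job K)

  record Block : Set where
    field
      jobs     : List (Job K)
      offline  : ℕ → List (Fin m)
      chainLen : Fin m → ℕ
      chainScn : Fin m → ℕ
  open Block public

  InRange : ℕ → ℕ → ℕ → Set
  InRange a T t = a ≤ t × t < a + T

  inRange? : ∀ a T t → Dec (InRange a T t)
  inRange? a T t = a ≤? t ×-dec t <? a + T

  algLoad : History → Block → Fin K → Fin m → ℕ
  algLoad h B = load (jobs B) (runFrom alg h (jobs B))

  offlineLoad : Block → ℕ → Fin K → Fin m → ℕ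
  offlineLoad B o = load (jobs B) (offline B o)

  -- Scenario indices double as job positions: the block built after history h only uses the
  -- scenarios in [|h|, |h| + T), so blocks built one after another never share a scenario.
  record Valid (n T : ℕ) (h : History) (B : Block) : Set where
    field
      length-jobs       : length (jobs B) ≡ T
      length-offline    : ∀ o → length (offline B o) ≡ length (jobs B)
      unit              : All (λ j → proj₁ j ≡ 1) (jobs B)
      empty-outside     : ∀ k → ¬ InRange (length h) T (toℕ k) → scenarioSize (jobs B) k ≡ 0
      chainLen≤m        : ∀ c → chainLen B c ≤ m
      chain-inRange     : ∀ c → 0 < chainLen B c → InRange (length h) T (chainScn B c)
      chain-algLoad     : ∀ c k i → 0 < chainLen B c → toℕ k ≡ chainScn B c →
                          algLoad h B k i ≡ (if ⌊ c ≟ i ⌋ then chainLen B c else 0)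
      chain-offlineLoad : ∀ c k o i → 0 < chainLen B c → toℕ k ≡ chainScn B c →
                          offlineLoad B o k i ≡ windowLoad o (chainLen B c) i
      offlineLoad≤1     : ∀ o k i → offlineLoad B o k i ≤ 1
      progress          : (∀ c → chainLen B c < m) → n ≤ ∑[ c < m ] chainLen B c
  open Valid public

  starts : (History → Block) → (r : ℕ) → History → Fin r → History
  starts f (suc r) h zero = h
  starts f (suc r) h (suc q) = starts f r (jobs (f h) ʳ++ h) q

  module Repeat (f : History → Block) (n T : ℕ) (valid : ∀ h → Valid n T h (f h)) where

    length-starts : ∀ r h (q : Fin r) → length (starts f r h q) ≡ length h + toℕ q * T
    length-starts (suc r) h zero = sym (+-identityʳ (length h))
    length-starts (suc r) h (suc q) = begin
      length (starts f r (jobs (f h) ʳ++ h) q)     ≡⟨ length-starts r _ q ⟩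
      length (jobs (f h) ʳ++ h) + toℕ q * T        ≡⟨ cong (_+ toℕ q * T) (length-ʳ++ (jobs (f h))) ⟩
      length (jobs (f h)) + length h + toℕ q * T   ≡⟨ cong (λ a → a + length h + toℕ q * T) (length-jobs (valid h)) ⟩
      T + length h + toℕ q * T                     ≡⟨ cong (_+ toℕ q * T) (+-comm T (length h)) ⟩
      length h + T + toℕ q * T                     ≡⟨ +-assoc (length h) T _ ⟩
      length h + (T + toℕ q * T)                   ∎
      where open ≡-Reasoning

    copy-end≤ : ∀ r h (q : Fin r) {b} → toℕ q < b → length (starts f r h q) + T ≤ length h + b * T
    copy-end≤ r h q {b} q<b = begin
      length (starts f r h q) + T   ≡⟨ cong (_+ T) (length-starts r h q) ⟩
      length h + toℕ q * T + T      ≡⟨ +-assoc (length h) _ T ⟩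
      length h + (toℕ q * T + T)    ≡⟨ cong (length h +_) (+-comm _ T) ⟩
      length h + suc (toℕ q) * T    ≤⟨ +-monoʳ-≤ (length h) (*-monoˡ-≤ T q<b) ⟩
      length h + b * T              ∎
      where open ≤-Reasoning

    copy⊆whole : ∀ r h (q : Fin r) {t} → InRange (length (starts f r h q)) T t → InRange (length h) (r * T) t
    copy⊆whole r h q (lo , hi) =
      ≤-trans (≤-trans (m≤m+n (length h) _) (≤-reflexive (sym (length-starts r h q)))) lo ,
      <-≤-trans hi (copy-end≤ r h q (Finₚ.toℕ<n q))

    copies-disjoint : ∀ r h (q q′ : Fin r) {t} → InRange (length (starts f r h q)) T t →
                      InRange (length (starts f r h q′)) T t → q ≡ q′
    copies-disjoint r h q q′ (lo , hi) (lo′ , hi′) with Finₚ.<-cmp q q′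
    ... | tri< q<q′ _ _ = ⊥-elim (<⇒≱ hi (≤-trans (copy-end≤ r h q q<q′) (subst (_≤ _) (length-starts r h q′) lo′)))
    ... | tri≈ _ q≡q′ _ = q≡q′
    ... | tri> _ _ q′<q = ⊥-elim (<⇒≱ hi′ (≤-trans (copy-end≤ r h q′ q′<q) (subst (_≤ _) (length-starts r h q) lo)))

    copy-containing : ∀ r h {t} → InRange (length h) (r * T) t → ∃[ q ] InRange (length (starts f r h q)) T t
    copy-containing zero h (lo , hi) = ⊥-elim (<⇒≱ hi (≤-trans (≤-reflexive (+-identityʳ _)) lo))
    copy-containing (suc r) h {t} (lo , hi) with t <? length h + T
    ... | yes in-first = zero , lo , in-first
    ... | no beyond with copy-containing r (jobs (f h) ʳ++ h) (lo′ , hi′)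
      where
      length-next : length (jobs (f h) ʳ++ h) ≡ length h + T
      length-next = trans (length-ʳ++ (jobs (f h)))
                          (trans (cong (_+ length h) (length-jobs (valid h))) (+-comm T (length h)))
      lo′ : length (jobs (f h) ʳ++ h) ≤ t
      lo′ = subst (_≤ t) (sym length-next) (≮⇒≥ beyond)
      hi′ : t < length (jobs (f h) ʳ++ h) + r * T
      hi′ = subst (t <_) (trans (sym (+-assoc (length h) T (r * T))) (cong (_+ r * T) (sym length-next))) hi
    ... | q , in-q = suc q , in-q

    module _ (r : ℕ) (h : History) where

      copy : Fin r → Block
      copy q = f (starts f r h q)

      copy-valid : ∀ q → Valid n T (starts f r h q) (copy q)
      copy-valid q = valid (starts f r h q)

      copyRun : Fin r → List (Fin m)
      copyRun q = runFrom alg (starts f r h q) (jobs (copy q))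

      repeatJobs : List (Job K)
      repeatJobs = concatFin r (jobs ∘ copy)

      repeatOffline : (Fin r → ℕ) → List (Fin m)
      repeatOffline offsets = concatFin r (λ q → offline (copy q) (offsets q))

      length-repeatJobs : length repeatJobs ≡ r * T
      length-repeatJobs = length-concatFin r (jobs ∘ copy) (length-jobs ∘ copy-valid)

      length-repeatOffline : ∀ offsets → length (repeatOffline offsets) ≡ length repeatJobs
      length-repeatOffline offsets =
        length-concatFin-≡ r (λ q → offline (copy q) (offsets q)) (jobs ∘ copy)
          (λ q → length-offline (copy-valid q) (offsets q))

      unit-repeat : All (λ j → proj₁ j ≡ 1) repeatJobs
      unit-repeat = All-concatFin r (jobs ∘ copy) (unit ∘ copy-valid)

      repeat-empty-outside : ∀ k → ¬ InRange (length h) (r * T) (toℕ k) → scenarioSize repeatJobs k ≡ 0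
      repeat-empty-outside k outside =
        scenarioSize-concatFin-empty r (jobs ∘ copy) k
          (λ q → empty-outside (copy-valid q) k (λ in-q → outside (copy⊆whole r h q in-q)))

      other-copies-empty : ∀ q k → InRange (length (starts f r h q)) T (toℕ k) →
                           ∀ q′ → q′ ≢ q → scenarioSize (jobs (copy q′)) k ≡ 0
      other-copies-empty q k in-q q′ q′≢q =
        empty-outside (copy-valid q′) k (λ in-q′ → q′≢q (copies-disjoint r h q′ q in-q′ in-q))

      repeat-offlineLoad-local : ∀ offsets q k i → InRange (length (starts f r h q)) T (toℕ k) →
                                 load repeatJobs (repeatOffline offsets) k i ≡ offlineLoad (copy q) (offsets q) k i
      repeat-offlineLoad-local offsets q k i in-q =
        load-concatFin-local r (jobs ∘ copy) (λ q → offline (copy q) (offsets q))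
          (λ q → length-offline (copy-valid q) (offsets q)) q k i (other-copies-empty q k in-q)

      repeat-offlineLoad≤1 : ∀ offsets k i → load repeatJobs (repeatOffline offsets) k i ≤ 1
      repeat-offlineLoad≤1 offsets k i with inRange? (length h) (r * T) (toℕ k)
      ... | yes inside = let q , in-q = copy-containing r h inside in
        ≤-trans (≤-reflexive (repeat-offlineLoad-local offsets q k i in-q)) (offlineLoad≤1 (copy-valid q) (offsets q) k i)
      ... | no outside =
        ≤-trans (≤-reflexive (load-empty repeatJobs (repeatOffline offsets) k i (repeat-empty-outside k outside))) z≤n

    runFrom-repeat : ∀ r h → runFrom alg h (repeatJobs r h) ≡ concatFin r (copyRun r h)
    runFrom-repeat zero h = refl
    runFrom-repeat (suc r) h = begin
      runFrom alg h (jobs (f h) ++ repeatJobs r h′)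
        ≡⟨ runFrom-++ alg h (jobs (f h)) (repeatJobs r h′) ⟩
      runFrom alg h (jobs (f h)) ++ runFrom alg h′ (repeatJobs r h′)
        ≡⟨ cong (runFrom alg h (jobs (f h)) ++_) (runFrom-repeat r h′) ⟩
      runFrom alg h (jobs (f h)) ++ concatFin r (copyRun r h′)
        ∎
      where
      open ≡-Reasoning
      h′ : History
      h′ = jobs (f h) ʳ++ h

    repeat-algLoad-local : ∀ r h q k i → InRange (length (starts f r h q)) T (toℕ k) →
                           load (repeatJobs r h) (runFrom alg h (repeatJobs r h)) k i ≡
                           algLoad (starts f r h q) (copy r h q) k i
    repeat-algLoad-local r h q k i in-q =
      trans (cong (λ τ → load (repeatJobs r h) τ k i) (runFrom-repeat r h))
            (load-concatFin-local r (jobs ∘ copy r h) (copyRun r h)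
               (λ q → length-runFrom alg (starts f r h q) (jobs (copy r h q))) q k i (other-copies-empty r h q k in-q))

  profile : Block → Fin (suc m ^ m)
  profile B = Fin.funToFin (λ c → chainLen B c mod suc m)

  profile-injective : ∀ {B B′} → (∀ c → chainLen B c ≤ m) → (∀ c → chainLen B′ c ≤ m) →
                      profile B ≡ profile B′ → ∀ c → chainLen B c ≡ chainLen B′ c
  profile-injective {B} {B′} ≤m ≤m′ same c = begin
    chainLen B c                    ≡⟨ m≤n⇒m%n≡m (≤m c) ⟨
    chainLen B c % suc m            ≡⟨ toℕ-fromℕ< _ ⟨
    toℕ (chainLen B c mod suc m)    ≡⟨ cong toℕ same-at-c ⟩
    toℕ (chainLen B′ c mod suc m)   ≡⟨ toℕ-fromℕ< _ ⟩
    chainLen B′ c % suc m           ≡⟨ m≤n⇒m%n≡m (≤m′ c) ⟩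
    chainLen B′ c                   ∎
    where
    open ≡-Reasoning
    same-at-c : chainLen B c mod suc m ≡ chainLen B′ c mod suc m
    same-at-c = begin
      chainLen B c mod suc m                                       ≡⟨ Finₚ.finToFun-funToFin (λ c → chainLen B c mod suc m) c ⟨
      Fin.finToFun (profile B) c                                   ≡⟨ cong (λ π → Fin.finToFun π c) same ⟩
      Fin.finToFun (profile B′) c                                  ≡⟨ Finₚ.finToFun-funToFin (λ c → chainLen B′ c mod suc m) c ⟩
      chainLen B′ c mod suc m                                      ∎

  module Grow (f : History → Block) (h : History) where

    start : Fin copies → History
    start = starts f copies h

    earlier : List (Job K)
    earlier = concatFin copies (λ q → jobs (f (start q)))

    -- The position of the new job, which also serves as its own fresh scenario.
    fresh : ℕ
    fresh = length (earlier ʳ++ h)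

    collision : ∃[ qi ] ∃[ qj ] (qi Fin.< qj × profile (f (start qi)) ≡ profile (f (start qj)))
    collision = Finₚ.pigeonhole (n<1+n _) (λ q → profile (f (start q)))

    qi qj : Fin copies
    qi = proj₁ collision
    qj = proj₁ (proj₂ collision)

    Bi Bj : Block
    Bi = f (start qi)
    Bj = f (start qj)

    Extendable : Fin m → Set
    Extendable c = 0 < chainLen Bi c × chainLen Bi c < m

    InNewJob : ℕ → Set
    InNewJob t = t ≡ fresh ⊎ ∃[ c ] (Extendable c × t ≡ chainScn Bi c)

    extendable? : ∀ c → Dec (Extendable c)
    extendable? c = 0 <? chainLen Bi c ×-dec chainLen Bi c <? m

    inNewJob? : ∀ t → Dec (InNewJob t)
    inNewJob? t = t ℕ.≟ fresh ⊎-dec Finₚ.any? (λ c → extendable? c ×-dec t ℕ.≟ chainScn Bi c)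

    newJob : Job K
    newJob = 1 , tabulate (λ k → ⌊ inNewJob? (toℕ k) ⌋)

    chosen : Fin m
    chosen = alg (earlier ʳ++ h) newJob

    newLen : Fin m → ℕ
    newLen c = if ⌊ chosen ≟ c ⌋ ∧ ⌊ chainLen Bi chosen <? m ⌋ then suc (chainLen Bi chosen) else chainLen Bj c

    newScn : Fin m → ℕ
    newScn c = if ⌊ chosen ≟ c ⌋ ∧ ⌊ chainLen Bi chosen <? m ⌋
               then (if ⌊ 0 <? chainLen Bi chosen ⌋ then chainScn Bi chosen else fresh)
               else chainScn Bj c

    -- Copy qi is laid out from suc o, leaving machineAt o, just before its chains' windows, to newJob.
    shift : ℕ → Fin copies → ℕ
    shift o q = if ⌊ q ≟ qi ⌋ then suc o else o

    grown : Block
    grown = record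
      { jobs     = earlier ++ newJob ∷ []
      ; offline  = λ o → concatFin copies (λ q → offline (f (start q)) (shift o q)) ++ machineAt o ∷ []
      ; chainLen = newLen
      ; chainScn = newScn
      }

    data NewChain (c : Fin m) : ℕ → ℕ → Set where
      inherited : NewChain c (chainLen Bj c) (chainScn Bj c)
      extended  : chosen ≡ c → Extendable chosen → NewChain c (suc (chainLen Bi chosen)) (chainScn Bi chosen)
      started   : chosen ≡ c → chainLen Bi chosen ≡ 0 → NewChain c (suc (chainLen Bi chosen)) fresh

    newChain : ∀ c → NewChain c (newLen c) (newScn c)
    newChain c = view (chosen ≟ c) (chainLen Bi chosen <? m) (0 <? chainLen Bi chosen)
      where
      view : (chosen≟c : Dec (chosen ≡ c)) (partial? : Dec (chainLen Bi chosen < m))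
             (nonempty? : Dec (0 < chainLen Bi chosen)) →
             NewChain c (if ⌊ chosen≟c ⌋ ∧ ⌊ partial? ⌋ then suc (chainLen Bi chosen) else chainLen Bj c)
                        (if ⌊ chosen≟c ⌋ ∧ ⌊ partial? ⌋
                         then (if ⌊ nonempty? ⌋ then chainScn Bi chosen else fresh)
                         else chainScn Bj c)
      view (no _)     _             _              = inherited
      view (yes refl) (no _)        _              = inherited
      view (yes refl) (yes partial) (yes nonempty) = extended refl (nonempty , partial)
      view (yes refl) (yes _)       (no empty)     = started refl (n≤0⇒n≡0 (≮⇒≥ empty))

  module GrowValid (f : History → Block) (n T : ℕ) (valid : ∀ h → Valid n T h (f h)) (h : History) where
    open Grow f h
    open Repeat f n T valid

    p : ℕ
    p = length h

    Vi : Valid n T (start qi) Bi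
    Vi = valid (start qi)

    Vj : Valid n T (start qj) Bj
    Vj = valid (start qj)

    qj≢qi : qj ≢ qi
    qj≢qi qj≡qi = Finₚ.<⇒≢ (proj₁ (proj₂ (proj₂ collision))) (sym qj≡qi)

    same-profile : ∀ c → chainLen Bi c ≡ chainLen Bj c
    same-profile = profile-injective {Bi} {Bj} (chainLen≤m Vi) (chainLen≤m Vj) (proj₂ (proj₂ (proj₂ collision)))

    fresh≡ : fresh ≡ copies * T + p
    fresh≡ = trans (length-ʳ++ earlier) (cong (_+ p) (length-repeatJobs copies h))

    widen : ∀ {t} → InRange p (copies * T) t → InRange p (suc (copies * T)) t
    widen (lo , hi) = lo , <-≤-trans hi (+-monoʳ-≤ p (n≤1+n _))

    fresh-inRange : InRange p (suc (copies * T)) fresh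
    fresh-inRange = subst (InRange p (suc (copies * T))) (sym fresh≡)
      (m≤n+m p _ , ≤-reflexive (trans (cong suc (+-comm _ p)) (sym (+-suc p _))))

    fresh∉earlier : ¬ InRange p (copies * T) fresh
    fresh∉earlier (_ , hi) = <⇒≢ hi (trans fresh≡ (+-comm _ p))

    earlier-empty-at-fresh : ∀ k → toℕ k ≡ fresh → scenarioSize earlier k ≡ 0
    earlier-empty-at-fresh k k≡fresh =
      repeat-empty-outside copies h k (λ inside → fresh∉earlier (subst (InRange p _) k≡fresh inside))

    inNewJob-inRange : ∀ {t} → InNewJob t → InRange p (suc (copies * T)) t
    inNewJob-inRange (inj₁ refl) = fresh-inRange
    inNewJob-inRange (inj₂ (c , (nonempty , _) , refl)) = widen (copy⊆whole copies h qi (chain-inRange Vi c nonempty))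

    inNewJob⇒qi : ∀ q {t} → InRange (length (start q)) T t → InNewJob t → q ≡ qi
    inNewJob⇒qi q in-q (inj₁ refl) = ⊥-elim (fresh∉earlier (copy⊆whole copies h q in-q))
    inNewJob⇒qi q in-q (inj₂ (c , (nonempty , _) , refl)) =
      copies-disjoint copies h q qi in-q (chain-inRange Vi c nonempty)

    inScen-newJob : ∀ k → inScen k newJob ≡ ⌊ inNewJob? (toℕ k) ⌋
    inScen-newJob k = lookup∘tabulate (λ k → ⌊ inNewJob? (toℕ k) ⌋) k

    newJobLoad : Fin K → Fin m → Fin m → ℕ
    newJobLoad k t i = if inScen k newJob ∧ ⌊ t ≟ i ⌋ then 1 else 0

    newJob-counted : ∀ k (t i : Fin m) → InNewJob (toℕ k) →
                     newJobLoad k t i ≡ (if ⌊ t ≟ i ⌋ then 1 else 0)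
    newJob-counted k t i present =
      cong (λ b → if b ∧ ⌊ t ≟ i ⌋ then 1 else 0) (trans (inScen-newJob k) (⌊⌋-yes (inNewJob? _) present))

    newJob-not-counted : ∀ k (t i : Fin m) → ¬ InNewJob (toℕ k) → newJobLoad k t i ≡ 0
    newJob-not-counted k t i absent =
      cong (λ b → if b ∧ ⌊ t ≟ i ⌋ then 1 else 0) (trans (inScen-newJob k) (⌊⌋-no (inNewJob? _) absent))

    shift-qi : ∀ o → shift o qi ≡ suc o
    shift-qi o = cong (if_then suc o else o) (⌊⌋-yes (qi ≟ qi) refl)

    shift-other : ∀ o {q} → q ≢ qi → shift o q ≡ o
    shift-other o {q} q≢qi = cong (if_then suc o else o) (⌊⌋-no (q ≟ qi) q≢qi)

    grown-algLoad : ∀ k i → algLoad h grown k i ≡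
                    load earlier (runFrom alg h earlier) k i + newJobLoad k chosen i
    grown-algLoad k i =
      trans (cong (λ τ → load (earlier ++ newJob ∷ []) τ k i) (runFrom-++ alg h earlier (newJob ∷ [])))
            (load-snoc earlier newJob (runFrom alg h earlier) chosen (length-runFrom alg h earlier) k i)

    grown-offlineLoad : ∀ o k i → offlineLoad grown o k i ≡
                        load earlier (repeatOffline copies h (shift o)) k i + newJobLoad k (machineAt o) i
    grown-offlineLoad o k i =
      load-snoc earlier newJob (repeatOffline copies h (shift o)) (machineAt o) (length-repeatOffline copies h (shift o)) k i

    algLoad-in-copy : ∀ q k i → InRange (length (start q)) T (toℕ k) →
                      algLoad h grown k i ≡ algLoad (start q) (f (start q)) k i + newJobLoad k chosen i
    algLoad-in-copy q k i in-q = trans (grown-algLoad k i) (cong (_+ _) (repeat-algLoad-local copies h q k i in-q))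

    offlineLoad-in-copy : ∀ o q k i → InRange (length (start q)) T (toℕ k) →
                          offlineLoad grown o k i ≡
                          offlineLoad (f (start q)) (shift o q) k i + newJobLoad k (machineAt o) i
    offlineLoad-in-copy o q k i in-q =
      trans (grown-offlineLoad o k i) (cong (_+ _) (repeat-offlineLoad-local copies h (shift o) q k i in-q))

    algLoad-at-fresh : ∀ k i → toℕ k ≡ fresh → algLoad h grown k i ≡ (if ⌊ chosen ≟ i ⌋ then 1 else 0)
    algLoad-at-fresh k i k≡fresh = trans (grown-algLoad k i)
      (cong₂ _+_ (load-empty earlier (runFrom alg h earlier) k i (earlier-empty-at-fresh k k≡fresh))
                 (newJob-counted k chosen i (inj₁ k≡fresh)))

    offlineLoad-at-fresh : ∀ o k i → toℕ k ≡ fresh → offlineLoad grown o k i ≡ (if ⌊ machineAt o ≟ i ⌋ then 1 else 0)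
    offlineLoad-at-fresh o k i k≡fresh = trans (grown-offlineLoad o k i)
      (cong₂ _+_ (load-empty earlier (repeatOffline copies h (shift o)) k i (earlier-empty-at-fresh k k≡fresh))
                 (newJob-counted k (machineAt o) i (inj₁ k≡fresh)))

    inherited-scenario : ∀ c (k : Fin K) → 0 < chainLen Bj c → toℕ k ≡ chainScn Bj c →
                         InRange (length (start qj)) T (toℕ k) × ¬ InNewJob (toℕ k)
    inherited-scenario c k nonempty k≡ = in-qj , λ present → qj≢qi (inNewJob⇒qi qj in-qj present)
      where
      in-qj : InRange (length (start qj)) T (toℕ k)
      in-qj = subst (InRange _ T) (sym k≡) (chain-inRange Vj c nonempty)

    extendable-scenario : ∀ c (k : Fin K) → Extendable c → toℕ k ≡ chainScn Bi c → InRange (length (start qi)) T (toℕ k)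
    extendable-scenario c k (nonempty , _) k≡ = subst (InRange _ T) (sym k≡) (chain-inRange Vi c nonempty)

    offlineLoad-extendable : ∀ o c k i → Extendable c → toℕ k ≡ chainScn Bi c →
                       offlineLoad grown o k i ≡ windowLoad o (suc (chainLen Bi c)) i
    offlineLoad-extendable o c k i extendable k≡ = begin
      offlineLoad grown o k i
        ≡⟨ offlineLoad-in-copy o qi k i (extendable-scenario c k extendable k≡) ⟩
      offlineLoad Bi (shift o qi) k i + newJobLoad k (machineAt o) i
        ≡⟨ cong₂ _+_ (cong (λ o′ → offlineLoad Bi o′ k i) (shift-qi o))
                     (newJob-counted k (machineAt o) i (inj₂ (c , extendable , k≡))) ⟩
      offlineLoad Bi (suc o) k i + (if ⌊ machineAt o ≟ i ⌋ then 1 else 0)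
        ≡⟨ cong (_+ _) (chain-offlineLoad Vi c k (suc o) i (proj₁ extendable) k≡) ⟩
      windowLoad (suc o) (chainLen Bi c) i + (if ⌊ machineAt o ≟ i ⌋ then 1 else 0)
        ≡⟨ +-comm (windowLoad (suc o) (chainLen Bi c) i) _ ⟩
      windowLoad o (suc (chainLen Bi c)) i
        ∎
      where open ≡-Reasoning

    newChain-bounded : ∀ {c len scn} → NewChain c len scn → len ≤ m
    newChain-bounded {c} inherited = chainLen≤m Vj c
    newChain-bounded (extended _ (_ , partial)) = partial
    newChain-bounded (started _ empty) = subst (λ l → suc l ≤ m) (sym empty) (s≤s z≤n)

    newChain-inRange : ∀ {c len scn} → NewChain c len scn → 0 < len → InRange p (suc (copies * T)) scn
    newChain-inRange {c} inherited nonempty = widen (copy⊆whole copies h qj (chain-inRange Vj c nonempty))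
    newChain-inRange (extended _ (nonempty , _)) _ = widen (copy⊆whole copies h qi (chain-inRange Vi chosen nonempty))
    newChain-inRange (started _ _) _ = fresh-inRange

    newChain-algLoad : ∀ {c len scn} → NewChain c len scn → 0 < len → ∀ k i → toℕ k ≡ scn →
                       algLoad h grown k i ≡ (if ⌊ c ≟ i ⌋ then len else 0)
    newChain-algLoad {c} inherited nonempty k i k≡ = begin
      algLoad h grown k i
        ≡⟨ algLoad-in-copy qj k i in-qj ⟩
      algLoad (start qj) Bj k i + newJobLoad k chosen i
        ≡⟨ cong₂ _+_ (chain-algLoad Vj c k i nonempty k≡) (newJob-not-counted k chosen i absent) ⟩
      (if ⌊ c ≟ i ⌋ then chainLen Bj c else 0) + 0
        ≡⟨ +-identityʳ _ ⟩
      (if ⌊ c ≟ i ⌋ then chainLen Bj c else 0)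
        ∎
      where
      open ≡-Reasoning
      in-qj : InRange (length (start qj)) T (toℕ k)
      in-qj = proj₁ (inherited-scenario c k nonempty k≡)
      absent : ¬ InNewJob (toℕ k)
      absent = proj₂ (inherited-scenario c k nonempty k≡)
    newChain-algLoad (extended refl extendable) _ k i k≡ = begin
      algLoad h grown k i
        ≡⟨ algLoad-in-copy qi k i (extendable-scenario chosen k extendable k≡) ⟩
      algLoad (start qi) Bi k i + newJobLoad k chosen i
        ≡⟨ cong₂ _+_ (chain-algLoad Vi chosen k i (proj₁ extendable) k≡)
                     (newJob-counted k chosen i (inj₂ (chosen , extendable , k≡))) ⟩
      (if ⌊ chosen ≟ i ⌋ then chainLen Bi chosen else 0) + (if ⌊ chosen ≟ i ⌋ then 1 else 0)
        ≡⟨ if-+-if ⌊ chosen ≟ i ⌋ (chainLen Bi chosen) 1 ⟩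
      (if ⌊ chosen ≟ i ⌋ then chainLen Bi chosen + 1 else 0)
        ≡⟨ cong (λ l → if ⌊ chosen ≟ i ⌋ then l else 0) (+-comm (chainLen Bi chosen) 1) ⟩
      (if ⌊ chosen ≟ i ⌋ then suc (chainLen Bi chosen) else 0)
        ∎
      where open ≡-Reasoning
    newChain-algLoad (started refl empty) _ k i k≡fresh =
      trans (algLoad-at-fresh k i k≡fresh) (cong (λ l → if ⌊ chosen ≟ i ⌋ then suc l else 0) (sym empty))

    newChain-offlineLoad : ∀ {c len scn} → NewChain c len scn → 0 < len → ∀ k o i → toℕ k ≡ scn →
                           offlineLoad grown o k i ≡ windowLoad o len i
    newChain-offlineLoad {c} inherited nonempty k o i k≡ = begin
      offlineLoad grown o k i
        ≡⟨ offlineLoad-in-copy o qj k i in-qj ⟩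
      offlineLoad Bj (shift o qj) k i + newJobLoad k (machineAt o) i
        ≡⟨ cong₂ _+_ (cong (λ o′ → offlineLoad Bj o′ k i) (shift-other o qj≢qi))
                     (newJob-not-counted k (machineAt o) i absent) ⟩
      offlineLoad Bj o k i + 0
        ≡⟨ +-identityʳ _ ⟩
      offlineLoad Bj o k i
        ≡⟨ chain-offlineLoad Vj c k o i nonempty k≡ ⟩
      windowLoad o (chainLen Bj c) i
        ∎
      where
      open ≡-Reasoning
      in-qj : InRange (length (start qj)) T (toℕ k)
      in-qj = proj₁ (inherited-scenario c k nonempty k≡)
      absent : ¬ InNewJob (toℕ k)
      absent = proj₂ (inherited-scenario c k nonempty k≡)
    newChain-offlineLoad (extended refl extendable) _ k o i k≡ = offlineLoad-extendable o chosen k i extendable k≡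
    newChain-offlineLoad (started refl empty) _ k o i k≡fresh =
      trans (offlineLoad-at-fresh o k i k≡fresh)
            (trans (sym (+-identityʳ _)) (cong (λ l → windowLoad o (suc l) i) (sym empty)))

    grown-offlineLoad≤1 : ∀ o k i → offlineLoad grown o k i ≤ 1
    grown-offlineLoad≤1 o k i = by-membership (inNewJob? (toℕ k))
      where
      open ≤-Reasoning
      earlierLoad : ℕ
      earlierLoad = load earlier (repeatOffline copies h (shift o)) k i
      by-membership : Dec (InNewJob (toℕ k)) → offlineLoad grown o k i ≤ 1
      by-membership (yes (inj₁ k≡fresh)) = ≤-trans (≤-reflexive (offlineLoad-at-fresh o k i k≡fresh)) (if≤1 _)
      by-membership (yes (inj₂ (c , extendable , k≡))) =
        ≤-trans (≤-reflexive (offlineLoad-extendable o c k i extendable k≡)) (windowLoad≤1 o _ i (proj₂ extendable))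
      by-membership (no absent) = begin
        offlineLoad grown o k i                      ≡⟨ grown-offlineLoad o k i ⟩
        earlierLoad + newJobLoad k (machineAt o) i   ≡⟨ cong (earlierLoad +_) (newJob-not-counted k (machineAt o) i absent) ⟩
        earlierLoad + 0                              ≡⟨ +-identityʳ earlierLoad ⟩
        earlierLoad                                  ≤⟨ repeat-offlineLoad≤1 copies h (shift o) k i ⟩
        1                                            ∎

    grown-empty-outside : ∀ k → ¬ InRange p (suc (copies * T)) (toℕ k) → scenarioSize (earlier ++ newJob ∷ []) k ≡ 0
    grown-empty-outside k outside = begin
      scenarioSize (earlier ++ newJob ∷ []) k
        ≡⟨ scenarioSize-snoc earlier newJob k ⟩
      scenarioSize earlier k + (if inScen k newJob then 1 else 0)
        ≡⟨ cong₂ _+_ (repeat-empty-outside copies h k (λ inside → outside (widen inside)))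
                     (cong (if_then 1 else 0)
                           (trans (inScen-newJob k) (⌊⌋-no (inNewJob? _) (λ present → outside (inNewJob-inRange present))))) ⟩
      0 ∎
      where open ≡-Reasoning

    newLen-grows : chainLen Bi chosen < m → ∀ c → newLen c ≡ chainLen Bj c + (if ⌊ chosen ≟ c ⌋ then 1 else 0)
    newLen-grows partial c =
      trans (cong (λ g → if ⌊ chosen ≟ c ⌋ ∧ g then suc (chainLen Bi chosen) else chainLen Bj c)
                  (⌊⌋-yes (chainLen Bi chosen <? m) partial))
            (by-machine (chosen ≟ c))
      where
      by-machine : (chosen≟c : Dec (chosen ≡ c)) →
                   (if ⌊ chosen≟c ⌋ ∧ true then suc (chainLen Bi chosen) else chainLen Bj c) ≡
                   chainLen Bj c + (if ⌊ chosen≟c ⌋ then 1 else 0)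
      by-machine (yes refl) = trans (cong suc (same-profile chosen)) (+-comm 1 (chainLen Bj chosen))
      by-machine (no _) = sym (+-identityʳ _)

    newLen-stuck : ¬ chainLen Bi chosen < m → newLen chosen ≡ chainLen Bj chosen
    newLen-stuck full = cong (if_then suc (chainLen Bi chosen) else chainLen Bj chosen)
                             (trans (cong (⌊ chosen ≟ chosen ⌋ ∧_) (⌊⌋-no (chainLen Bi chosen <? m) full)) (∧-zeroʳ _))

    grown-progress : (∀ c → newLen c < m) → suc n ≤ ∑[ c < m ] newLen c
    grown-progress all< = by-growth (chainLen Bi chosen <? m)
      where
      by-growth : Dec (chainLen Bi chosen < m) → suc n ≤ ∑[ c < m ] newLen c
      by-growth (no full) = ⊥-elim (full (subst (_< m) (trans (newLen-stuck full) (sym (same-profile chosen))) (all< chosen)))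
      by-growth (yes partial) = begin
        suc n
          ≤⟨ s≤s (progress Vj Bj-unfinished) ⟩
        suc (∑[ c < m ] chainLen Bj c)
          ≡⟨ +-comm 1 _ ⟩
        ∑[ c < m ] chainLen Bj c + 1
          ≡⟨ cong (∑[ c < m ] chainLen Bj c +_) (∑-indicator chosen 1) ⟨
        ∑[ c < m ] chainLen Bj c + ∑[ c < m ] (if ⌊ chosen ≟ c ⌋ then 1 else 0)
          ≡⟨ ∑-distrib-+ (chainLen Bj) (λ c → if ⌊ chosen ≟ c ⌋ then 1 else 0) ⟨
        ∑[ c < m ] (chainLen Bj c + (if ⌊ chosen ≟ c ⌋ then 1 else 0))
          ≡⟨ sum-cong-≗ (newLen-grows partial) ⟨
        ∑[ c < m ] newLen c
          ∎
        where
        open ≤-Reasoning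
        Bj-unfinished : ∀ c → chainLen Bj c < m
        Bj-unfinished c = ≤-<-trans (subst (chainLen Bj c ≤_) (sym (newLen-grows partial c)) (m≤m+n _ _)) (all< c)

    grown-valid : Valid (suc n) (suc (copies * T)) h grown
    grown-valid = record
      { length-jobs       = trans (length-++ earlier) (trans (cong (_+ 1) (length-repeatJobs copies h)) (+-comm _ 1))
      ; length-offline    = λ o → trans (length-++ (repeatOffline copies h (shift o)))
                                   (trans (cong (_+ 1) (length-repeatOffline copies h (shift o))) (sym (length-++ earlier)))
      ; unit              = Allₚ.++⁺ (unit-repeat copies h) (refl ∷ [])
      ; empty-outside     = grown-empty-outside
      ; chainLen≤m        = λ c → newChain-bounded (newChain c)
      ; chain-inRange     = λ c → newChain-inRange (newChain c)
      ; chain-algLoad     = λ c k i nonempty → newChain-algLoad (newChain c) nonempty k i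
      ; chain-offlineLoad = λ c k o i nonempty → newChain-offlineLoad (newChain c) nonempty k o i
      ; offlineLoad≤1     = grown-offlineLoad≤1
      ; progress          = grown-progress
      }

  block : ℕ → History → Block
  block zero h = record { jobs = [] ; offline = λ _ → [] ; chainLen = λ _ → 0 ; chainScn = λ _ → 0 }
  block (suc n) h = Grow.grown (block n) h

  block-valid : ∀ n h → Valid n (blockSize n) h (block n h)
  block-valid zero h = record
    { length-jobs       = refl
    ; length-offline    = λ _ → refl
    ; unit              = []
    ; empty-outside     = λ _ _ → refl
    ; chainLen≤m        = λ _ → z≤n
    ; chain-inRange     = λ _ ()
    ; chain-algLoad     = λ _ _ _ ()
    ; chain-offlineLoad = λ _ _ _ _ ()
    ; offlineLoad≤1     = λ _ _ _ → z≤n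
    ; progress          = λ _ → z≤n
    }
  block-valid (suc n) h = GrowValid.grown-valid (block n) n (blockSize n) (block-valid n) h

  full-chain : ∀ {T h B} → Valid (m * m) T h B → ∃[ c ] chainLen B c ≡ m
  full-chain {B = B} V with Finₚ.any? (λ c → m ≤? chainLen B c)
  ... | yes (c , full) = c , ≤-antisym (chainLen≤m V c) full
  ... | no none = ⊥-elim (<⇒≱ m*m'<m*m (begin
      m * m                      ≤⟨ progress V (λ c → ≰⇒> (λ full → none (c , full))) ⟩
      ∑[ c < m ] chainLen B c    ≤⟨ ∑-bound (chainLen B) (λ c → ≤-pred (≰⇒> (λ full → none (c , full)))) ⟩
      m * m'                     ∎))
    where
    open ≤-Reasoning
    m*m'<m*m : m * m' < m * m
    m*m'<m*m = subst (m * m' <_) (sym (*-suc m m')) (m<n+m (m * m') {m} (s≤s z≤n))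

  hard : Block
  hard = block (m * m) []

  hard-valid : Valid (m * m) (blockSize (m * m)) [] hard
  hard-valid = block-valid (m * m) []

  full-chain-forces-m : ∀ {n T B} → Valid n T [] B → T ≤ K → ∀ c → chainLen B c ≡ m → ∃[ k ] m ≤ algLoad [] B k c
  full-chain-forces-m {B = B} V T≤K c len≡m = k , ≤-reflexive (sym (begin
    algLoad [] B k c                          ≡⟨ chain-algLoad V c k c nonempty (toℕ-fromℕ< _) ⟩
    (if ⌊ c ≟ c ⌋ then chainLen B c else 0)   ≡⟨ cong (if_then chainLen B c else 0) (⌊⌋-yes (c ≟ c) refl) ⟩
    chainLen B c                              ≡⟨ len≡m ⟩
    m                                         ∎))
    where
    open ≡-Reasoning
    nonempty : 0 < chainLen B c
    nonempty = subst (0 <_) (sym len≡m) (s≤s z≤n)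
    k : Fin K
    k = fromℕ< (<-≤-trans (proj₂ (chain-inRange V c nonempty)) T≤K)

mainTheorem12 : (m : ℕ) → 1 ≤ m →
    ∃[ Km ] ((K : ℕ) → Km ≤ K → (a b : ℕ) → 1 ≤ a → 1 ≤ b →
      (alg : OnlineAlg K m) → ¬ CompetitiveUnitSmall {K} {m} a b alg)
mainTheorem12 (suc m′) _ = blockSize (m * m) , λ K enough a b 1≤a _ alg →
  let open Adversary m′ K alg
      c , full = full-chain hard-valid
      k , forced = full-chain-forces-m hard-valid enough c full
  in not-competitive alg (jobs hard) (offline hard 0) (unit hard-valid) (length-offline hard-valid 0)
                     (offlineLoad≤1 hard-valid 0) k c forced a b 1≤a
  where open Machines m′
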